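{- Let $V_1,\ldots,V_n$ be pairwise disjoint sets with $|V_i|=n$ for all $i\in\{1,\ldots,n\}$, let $\Omega\subseteq V_1\times\cdots\times V_n$ be a nonempty octahedral system, and let $(\mathcal U,\Omega_2,\ldots,\Omega_n)$ be a suitable decomposition of $\Omega$. Let $\mathcal O\subseteq\{\Omega_2,\ldots,\Omega_n\}$ be such that for each $\Omega_j\in\mathcal O$ there is a class $V_i$ which is covered in $\Omega_j$ and in no other $\Omega_\ell\in\mathcal O$. Let $\mathcal P\subseteq\mathcal O$ be the set of members of $\mathcal O$ that are umbrellas. Then $$|\Omega|\geq|\mathcal U|(n-|\mathcal O|)+\sum_{\Omega_j\in\mathcal O}|\Omega_j|-|\mathcal U|(|\mathcal O|-|\mathcal P|)-|\mathcal U|-|\mathcal P|+1.$$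
   Context: An octahedral system is a set $\Omega\subseteq V_1\times\cdots\times V_n$ (the $V_i$ are classes, their elements vertices) such that $|\Omega\cap(X_1\times\cdots\times X_n)|$ is even whenever $X_i\subseteq V_i$, $|X_i|=2$ for all $i$. Elements of $\Omega$ are edges; an edge is incident with $x\in V_i$ if its $i$th component is $x$. $\delta_\Omega(x)$ denotes the set of edges of $\Omega$ incident with $x$ and $\deg_\Omega(x)=|\delta_\Omega(x)|$. A class is covered in $\Omega$ if each of its vertices has degree at least $1$. An umbrella is a set $\{x^{(1)}\}\times\cdots\times\{x^{(i-1)}\}\times V_i\times\{x^{(i+1)}\}\times\cdots\times\{x^{(n)}\}$ with $x^{(j)}\in V_j$ for $j\neq i$; $V_i$ is its colour. $\triangle$ denotes symmetric difference; for a family of sets, $\triangle$ of the family is the set of elements lying in an odd number of its members. Suitable decomposition: given a nonempty octahedral system $\Omega$ with $|V_i|=n$ for all $i$, let $i_1$ be the smallest index such that $V_{i_1}$ is covered in $\Omega$; label the vertices of $V_{i_1}$ as $x_1,\ldots,x_n$ so that $\deg_\Omega(x_1)\leq\cdots\leq\deg_\Omega(x_n)$; let $\mathcal U$ be the set of umbrellas of colour $V_{i_1}$ having nonempty intersection with $\delta_\Omega(x_1)$; let $W=\triangle_{U\in\mathcal U}U$ and $\Omega_j=\delta_{\Omega\triangle W}(x_j)$ for $j=2,\ldots,n$. The tuple $(\mathcal U,\Omega_2,\ldots,\Omega_n)$ is called a suitable decomposition of $\Omega$. -}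

module Defs where

open import Data.Nat using (ℕ; zero; suc; _+_; _<_; _≤_)
open import Data.Nat.Divisibility using (_∣_)
open import Data.Bool using (Bool; true; false; _∧_; _xor_; if_then_else_; not)
open import Data.Fin as Fin using (Fin; toℕ) renaming (_≟_ to _≟ᶠ_; _≤_ to _≤ᶠ_)
open import Data.Vec using (Vec; []; _∷_; lookup; removeAt)
open import Data.Vec.Properties using (≡-dec)
open import Data.List using (List; []; _∷_; concatMap; map; allFin)
open import Data.Bool.ListAction using (all; any)
open import Data.Nat.ListAction using (sum)
open import Data.Fin.Permutation using (Permutation′; _⟨$⟩ʳ_)
open import Data.Product using (Σ; _×_; ∃; ∃-syntax)
open import Relation.Nullary using (¬_; ⌊_⌋)
open import Relation.Binary.PropositionalEquality using (_≡_; _≢_)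
open import Function.Bundles using (_⇔_)

-- The (pairwise disjoint)
-- classes are modelled as n tagged copies of Fin n; class V_i is the copy
-- with tag i, so vertex x of class i is the pair (i , x).  An edge of
-- V_1 × ⋯ × V_n is a vector e : Vec (Fin n) n (its i-th component lies in V_i).

Edge : ℕ → Set
Edge n = Vec (Fin n) n

EdgeSet : ℕ → Set
EdgeSet n = Edge n → Bool

allVecs : (k m : ℕ) → List (Vec (Fin k) m)
allVecs k zero    = [] ∷ []
allVecs k (suc m) = concatMap (λ v → map (λ x → x ∷ v) (allFin k)) (allVecs k m)

count : {A : Set} → (A → Bool) → List A → ℕ
count P xs = sum (map (λ x → if P x then 1 else 0) xs)

card : {n : ℕ} → EdgeSet n → ℕ
card {n} S = count S (allVecs n n)

_==_ : {n : ℕ} → Fin n → Fin n → Bool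
x == y = ⌊ x ≟ᶠ y ⌋

inBox : {n : ℕ} → Edge n → Edge n → Edge n → Bool
inBox {n} a b e = all (λ i → (lookup e i == lookup a i) Data.Bool.∨ (lookup e i == lookup b i)) (allFin n)

-- every choice of 2-element sets X_i = {a_i , b_i} ⊆ V_i (a_i ≠ b_i)
-- meets Ω in an even number of edges
Octahedral : {n : ℕ} → EdgeSet n → Set
Octahedral {n} Ω =
  (a b : Edge n) → (∀ i → lookup a i ≢ lookup b i) →
  2 ∣ card (λ e → Ω e ∧ inBox a b e)

Nonempty : {n : ℕ} → EdgeSet n → Set
Nonempty {n} Ω = ∃[ e ] Ω e ≡ true

δ : {n : ℕ} → EdgeSet n → Fin n → Fin n → EdgeSet n
δ Ω i x e = Ω e ∧ (lookup e i == x)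

deg : {n : ℕ} → EdgeSet n → Fin n → Fin n → ℕ
deg Ω i x = card (δ Ω i x)

Covered : {n : ℕ} → EdgeSet n → Fin n → Set
Covered {n} Ω i = (x : Fin n) → 1 ≤ deg Ω i x

_△_ : {n : ℕ} → EdgeSet n → EdgeSet n → EdgeSet n
(A △ B) e = A e xor B e

-- An umbrella of colour V_i is
-- {x⁽¹⁾}×⋯×V_i×⋯×{x⁽ⁿ⁾}; it is determined by its colour i and the tuple
-- c = (x⁽ʲ⁾)_{j≠i} : Vec (Fin n) m (the edge tuple with coordinate i removed).

umbrella : {m : ℕ} → Fin (suc m) → Vec (Fin (suc m)) m → EdgeSet (suc m)
umbrella i c e = ⌊ ≡-dec _≟ᶠ_ (removeAt e i) c ⌋

IsUmbrella : {m : ℕ} → EdgeSet (suc m) → Set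
IsUmbrella {m} S = ∃[ i ] ∃[ c ] ((e : Edge (suc m)) → S e ≡ umbrella i c e)

-- a set of umbrellas of colour i is a Boolean predicate on the codes c
UmbrellaSet : ℕ → Set
UmbrellaSet m = Vec (Fin (suc m)) m → Bool

cardU : {m : ℕ} → UmbrellaSet m → ℕ
cardU {m} 𝒰 = count 𝒰 (allVecs (suc m) m)

-- △ of the family {umbrella i c | 𝒰 c}: edges lying in an odd number of members
△Family : {m : ℕ} → Fin (suc m) → UmbrellaSet m → EdgeSet (suc m)
△Family {m} i 𝒰 e = isOdd (count (λ c → 𝒰 c ∧ umbrella i c e) (allVecs (suc m) m))
  where
  isOdd : ℕ → Bool
  isOdd zero          = false
  isOdd (suc zero)    = true
  isOdd (suc (suc k)) = isOdd k

-- Suitable decomposition (𝒰, Ω₂, …, Ωₙ) of Ω, with n = suc m.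
-- Ωs k stands for Ω_{k+2}  (k : Fin m), i.e. Ωs k = δ_{Ω△W}(x_{k+2}).
-- The labelling x_1,…,x_n of V_{i₁} is a permutation σ of Fin n with
-- x_{j+1} = σ ⟨$⟩ʳ j, nondecreasing in degree.

record SuitableDecomposition {m : ℕ} (Ω : EdgeSet (suc m))
         (𝒰 : UmbrellaSet m) (Ωs : Fin m → EdgeSet (suc m)) : Set where
  field
    i₁         : Fin (suc m)
    i₁-covered : Covered Ω i₁
    i₁-least   : (i : Fin (suc m)) → toℕ i < toℕ i₁ → ¬ Covered Ω i
    σ          : Permutation′ (suc m)
    σ-sorted   : (j k : Fin (suc m)) → j ≤ᶠ k →
                 deg Ω i₁ (σ ⟨$⟩ʳ j) ≤ deg Ω i₁ (σ ⟨$⟩ʳ k)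
  x : Fin (suc m) → Fin (suc m)
  x j = σ ⟨$⟩ʳ j
  -- x₁ = x zero
  field
    𝒰-def  : (c : Vec (Fin (suc m)) m) →
             𝒰 c ≡ any (λ e → umbrella i₁ c e ∧ δ Ω i₁ (x Fin.zero) e) (allVecs (suc m) (suc m))
  W : EdgeSet (suc m)
  W = △Family i₁ 𝒰
  field
    Ωs-def : (k : Fin m) (e : Edge (suc m)) → Ωs k e ≡ δ (Ω △ W) i₁ (x (Fin.suc k)) e

-- Subfamilies 𝒪 ⊆ {Ω₂,…,Ωₙ} are given by index predicates on Fin m.

cardI : {m : ℕ} → (Fin m → Bool) → ℕ
cardI {m} 𝒪 = count 𝒪 (allFin m)

sumOver : {m : ℕ} → (Fin m → Bool) → (Fin m → EdgeSet (suc m)) → ℕ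
sumOver {m} 𝒪 Ωs = sum (map (λ k → if 𝒪 k then card (Ωs k) else 0) (allFin m))

module Submission where

open import Defs

-- Write V = V_{i₁}.  An edge through a vertex z ∈ V is determined by its code (the
-- edge with coordinate i₁ deleted), so each fibre δ(z) is a set of codes.  Put
-- u = |𝒰| and, for j = 2,…,n, d_j = deg_Ω(x_j), s_j = |Ω_j| and t_j = the number of
-- codes in 𝒰 whose edge through x_j lies in Ω_j (in the file Ωs k is Ω_{k+2}).
--   (1) 𝒰 is the code set of δ_Ω(x₁) and W meets every fibre of V in 𝒰, so Ω_j is
--       the fibre of x_j twisted by 𝒰; counting gives d_j + 2 t_j = s_j + u, and
--       t_j ≤ u ≤ d_j, 1 ≤ u.  Summing degrees over V gives |Ω| = u + Σ_j d_j.
--   (2) An umbrella covers exactly its colour class, so the umbrellas in 𝒫 have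
--       pairwise distinct colours; two such umbrellas share at most one code on
--       fibres of V, whence t_j + t_l ≤ u + 1 for distinct Ω_j, Ω_l ∈ 𝒫.
--   (3) Hence s_j ≤ d_j + u for Ω_j ∈ 𝒪∖𝒫, s_j ≤ d_j + 1 + e_j for Ω_j ∈ 𝒫, and
--       u ≤ d_j for Ω_j ∉ 𝒪, where the excess e_j = 2t_j ∸ (u+1) ≤ u ∸ 1 is positive
--       for at most one j ∈ 𝒫.  Summing over j and passing to ℤ gives the claim.

module Development where

  open import Data.Nat using (ℕ; zero; suc; _+_; _*_; _∸_; _≤_; _<_; z≤n; s≤s)
  open import Data.Nat.Properties
  open import Data.Nat.ListAction using (sum)
  open import Data.Nat.ListAction.Properties using (sum-++)
  open import Data.Nat.Tactic.RingSolver using (solve-∀)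
  open import Data.Bool using (Bool; true; false; _∧_; _xor_; not; if_then_else_)
  open import Data.Bool.ListAction using (any)
  open import Data.Bool.Properties using (∧-assoc; ∧-zeroʳ; ∧-identityʳ)
  open import Data.Fin as Fin using (Fin; punchIn; punchOut) renaming (_≟_ to _≟ᶠ_)
  import Data.Fin.Properties as FinP
  open import Data.Fin.Permutation using (Permutation′; _⟨$⟩ʳ_)
  open import Data.Vec using (Vec; []; _∷_; lookup; insertAt; removeAt)
  open import Data.Vec.Properties
    using (≡-dec; insertAt-lookup; insertAt-punchIn; removeAt-punchOut; removeAt-insertAt;
           tabulate∘lookup; tabulate-cong)
  open import Data.List using (List; []; _∷_; _++_; map; concatMap; allFin)
  open import Data.List.Properties using (map-++; map-tabulate)
  open import Data.Product using (_×_; _,_; proj₁; proj₂; ∃-syntax)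
  open import Data.Empty using (⊥-elim)
  open import Relation.Nullary using (¬_; Dec; yes; no; ⌊_⌋; contradiction)
  open import Relation.Nullary.Decidable using (isYes≗does; dec-true; dec-false; ⌊⌋-map′)
  open import Relation.Binary.Definitions using (DecidableEquality)
  open import Relation.Binary.PropositionalEquality
  open import Function using (_∘_)
  open import Function.Bundles using (_⇔_; Equivalence)
  import Algebra.Properties.CommutativeMonoid.Sum as MonoidSum
  import Data.Integer as ℤ
  import Data.Integer.Properties as ℤP
  open import Data.Integer.Tactic.RingSolver renaming (solve-∀ to ℤ-solve-∀)

  variable
    A B : Set

  -- Finite sums.  ∑[ x ← xs ] f x sums f over the list xs; with the indicator ⟦_⟧,
  -- the function count P xs of Defs is definitionally ∑[ x ← xs ] ⟦ P x ⟧.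

  ∑ : List A → (A → ℕ) → ℕ
  ∑ xs f = sum (map f xs)

  syntax ∑ xs (λ x → e) = ∑[ x ← xs ] e

  when : Bool → ℕ → ℕ
  when b n = if b then n else 0

  ⟦_⟧ : Bool → ℕ
  ⟦ b ⟧ = when b 1

  when-≤ : (b : Bool) (n : ℕ) → when b n ≤ n
  when-≤ true  n = ≤-refl
  when-≤ false n = z≤n

  ⟦⟧-positive : (b : Bool) → 1 ≤ ⟦ b ⟧ → b ≡ true
  ⟦⟧-positive true _ = refl

  when-∧ : (a b : Bool) (n : ℕ) → when (a ∧ b) n ≡ when b (when a n)
  when-∧ true  b     n = refl
  when-∧ false true  n = refl
  when-∧ false false n = refl

  ⟦∧⟧ˡ : (a b : Bool) → ⟦ a ∧ b ⟧ ≡ when a ⟦ b ⟧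
  ⟦∧⟧ˡ true  b = refl
  ⟦∧⟧ˡ false b = refl

  ⟦∧⟧ʳ : (a b : Bool) → ⟦ a ∧ b ⟧ ≡ when b ⟦ a ⟧
  ⟦∧⟧ʳ true  b     = refl
  ⟦∧⟧ʳ false true  = refl
  ⟦∧⟧ʳ false false = refl

  ∧-split : (a b : Bool) → a ∧ b ≡ true → (a ≡ true) × (b ≡ true)
  ∧-split true true _ = refl , refl

  when-positive : (b : Bool) (n : ℕ) → 1 ≤ when b n → (b ≡ true) × (1 ≤ n)
  when-positive true n h = refl , h

  when-as-product : (b : Bool) (n : ℕ) → when b n ≡ n * ⟦ b ⟧
  when-as-product true  n = sym (*-identityʳ n)
  when-as-product false n = sym (*-zeroʳ n)

  ∑-++ : (xs ys : List A) (f : A → ℕ) → ∑ (xs ++ ys) f ≡ ∑ xs f + ∑ ys f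
  ∑-++ xs ys f = trans (cong sum (map-++ f xs ys)) (sum-++ (map f xs) (map f ys))

  ∑-concatMap : (h : A → List B) (xs : List A) (f : B → ℕ) →
    ∑ (concatMap h xs) f ≡ ∑[ x ← xs ] ∑ (h x) f
  ∑-concatMap h []       f = refl
  ∑-concatMap h (x ∷ xs) f =
    trans (∑-++ (h x) (concatMap h xs) f) (cong (∑ (h x) f +_) (∑-concatMap h xs f))

  ∑-map : (g : A → B) (xs : List A) (f : B → ℕ) → ∑ (map g xs) f ≡ ∑ xs (f ∘ g)
  ∑-map g []       f = refl
  ∑-map g (x ∷ xs) f = cong (f (g x) +_) (∑-map g xs f)

  ∑-cong : (xs : List A) {f g : A → ℕ} → (∀ x → f x ≡ g x) → ∑ xs f ≡ ∑ xs g
  ∑-cong []       e = refl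
  ∑-cong (x ∷ xs) e = cong₂ _+_ (e x) (∑-cong xs e)

  ∑-mono : (xs : List A) {f g : A → ℕ} → (∀ x → f x ≤ g x) → ∑ xs f ≤ ∑ xs g
  ∑-mono []       e = z≤n
  ∑-mono (x ∷ xs) e = +-mono-≤ (e x) (∑-mono xs e)

  ∑-zero : (xs : List A) {f : A → ℕ} → (∀ x → f x ≡ 0) → ∑ xs f ≡ 0
  ∑-zero []       e = refl
  ∑-zero (x ∷ xs) e = cong₂ _+_ (e x) (∑-zero xs e)

  ∑-+ : (xs : List A) (f g : A → ℕ) → ∑[ x ← xs ] (f x + g x) ≡ ∑ xs f + ∑ xs g
  ∑-+ []       f g = refl
  ∑-+ (x ∷ xs) f g =
    trans (cong (f x + g x +_) (∑-+ xs f g)) (interchange (f x) (g x) (∑ xs f) (∑ xs g))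
    where
    interchange : ∀ a b c d → a + b + (c + d) ≡ a + c + (b + d)
    interchange = solve-∀

  ∑-* : (xs : List A) (c : ℕ) (f : A → ℕ) → ∑[ x ← xs ] (c * f x) ≡ c * ∑ xs f
  ∑-* []       c f = sym (*-zeroʳ c)
  ∑-* (x ∷ xs) c f =
    trans (cong (c * f x +_) (∑-* xs c f)) (sym (*-distribˡ-+ c (f x) (∑ xs f)))

  ∑-swap : (xs : List A) (ys : List B) (f : A → B → ℕ) →
    ∑[ x ← xs ] ∑ ys (f x) ≡ ∑[ y ← ys ] ∑[ x ← xs ] f x y
  ∑-swap []       ys f = sym (∑-zero ys (λ _ → refl))
  ∑-swap (x ∷ xs) ys f =
    trans (cong (∑ ys (f x) +_) (∑-swap xs ys f)) (sym (∑-+ ys (f x) (λ y → ∑[ x′ ← xs ] f x′ y)))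

  ∑-positive : (xs : List A) (f : A → ℕ) → 1 ≤ ∑ xs f → ∃[ x ] 1 ≤ f x
  ∑-positive (x ∷ xs) f h with f x in fx
  ... | zero  = ∑-positive xs f h
  ... | suc _ = x , subst (1 ≤_) (sym fx) (s≤s z≤n)

  count-witness : (P : A → Bool) (xs : List A) → 1 ≤ count P xs → ∃[ x ] P x ≡ true
  count-witness P xs h with ∑-positive xs (λ x → ⟦ P x ⟧) h
  ... | x , px = x , ⟦⟧-positive (P x) px

  any-from-count : (P : A → Bool) (xs : List A) (b : Bool) → count P xs ≡ ⟦ b ⟧ → any P xs ≡ b
  any-from-count P []       false _ = refl
  any-from-count P (x ∷ xs) b     h with P x
  ... | false = any-from-count P xs b h
  ... | true  = sym (⟦⟧-positive b (subst (1 ≤_) h (s≤s z≤n)))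

  ⌊⌋-true : {P : Set} (d : Dec P) → P → ⌊ d ⌋ ≡ true
  ⌊⌋-true d p = trans (isYes≗does d) (dec-true d p)

  ⌊⌋-false : {P : Set} (d : Dec P) → ¬ P → ⌊ d ⌋ ≡ false
  ⌊⌋-false d ¬p = trans (isYes≗does d) (dec-false d ¬p)

  ⌊⌋-sound : {P : Set} (d : Dec P) → ⌊ d ⌋ ≡ true → P
  ⌊⌋-sound (yes p) _ = p

  ⌊≟⌋-sym : (_≟_ : DecidableEquality A) (x y : A) → ⌊ x ≟ y ⌋ ≡ ⌊ y ≟ x ⌋
  ⌊≟⌋-sym _≟_ x y with x ≟ y
  ... | yes refl = sym (⌊⌋-true (x ≟ x) refl)
  ... | no x≢y   = sym (⌊⌋-false (y ≟ x) (x≢y ∘ sym))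

  ⌊≟⌋-∷ : {k m : ℕ} (x y : Fin k) (v w : Vec (Fin k) m) →
    ⌊ ≡-dec _≟ᶠ_ (x ∷ v) (y ∷ w) ⌋ ≡ ⌊ x ≟ᶠ y ⌋ ∧ ⌊ ≡-dec _≟ᶠ_ v w ⌋
  ⌊≟⌋-∷ x y v w =
    trans (isYes≗does (≡-dec _≟ᶠ_ (x ∷ v) (y ∷ w)))
          (sym (cong₂ _∧_ (isYes≗does (x ≟ᶠ y)) (isYes≗does (≡-dec _≟ᶠ_ v w))))

  -- A list is sifting for a decidable equality when summing g against the test
  -- "x equals y" returns g y: every element occurs in it exactly once.
  record Sifting (_≟_ : DecidableEquality A) (xs : List A) : Set where
    field
      sifts : (y : A) (g : A → ℕ) → ∑[ x ← xs ] when ⌊ x ≟ y ⌋ (g x) ≡ g y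

  open Sifting

  term≤∑ : {_≟_ : DecidableEquality A} {xs : List A} → Sifting _≟_ xs →
    (f : A → ℕ) (y : A) → f y ≤ ∑ xs f
  term≤∑ {_≟_ = _≟_} {xs} sift f y =
    subst (_≤ ∑ xs f) (sifts sift y f) (∑-mono xs (λ x → when-≤ ⌊ x ≟ y ⌋ (f x)))

  ∑-single≤ : {_≟_ : DecidableEquality A} {xs : List A} → Sifting _≟_ xs →
    (f : A → ℕ) (c : ℕ) → (∀ x → f x ≤ c) →
    (∀ x y → 1 ≤ f x → 1 ≤ f y → x ≡ y) → ∑ xs f ≤ c
  ∑-single≤ {_≟_ = _≟_} {xs} sift f c bound unique with 1 ≤? ∑ xs f
  ... | no ∑<1 = ≤-trans (≤-reflexive (n<1⇒n≡0 (≰⇒> ∑<1))) z≤n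
  ... | yes ∑≥1 with ∑-positive xs f ∑≥1
  ...   | x₀ , fx₀ = subst (∑ xs f ≤_) (sifts sift x₀ (λ _ → c)) (∑-mono xs onlyAt-x₀)
    where
    onlyAt-x₀ : ∀ x → f x ≤ when ⌊ x ≟ x₀ ⌋ c
    onlyAt-x₀ x with 1 ≤? f x
    ... | yes fx rewrite unique x x₀ fx fx₀ | ⌊⌋-true (x₀ ≟ x₀) refl = bound x₀
    ... | no fx  = ≤-trans (≤-reflexive (n<1⇒n≡0 (≰⇒> fx))) z≤n

  ∑-allFin-suc : (k : ℕ) (h : Fin (suc k) → ℕ) →
    ∑ (allFin (suc k)) h ≡ h Fin.zero + ∑ (allFin k) (h ∘ Fin.suc)
  ∑-allFin-suc k h =
    cong (h Fin.zero +_)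
         (cong sum (trans (map-tabulate Fin.suc h) (sym (map-tabulate (λ x → x) (h ∘ Fin.suc)))))

  allFin-sifting : (k : ℕ) → Sifting _≟ᶠ_ (allFin k)
  sifts (allFin-sifting k) = allFin-sifts k
    where
    allFin-sifts : (k : ℕ) (y : Fin k) (g : Fin k → ℕ) → ∑[ x ← allFin k ] when ⌊ x ≟ᶠ y ⌋ (g x) ≡ g y
    allFin-sifts (suc k) Fin.zero g =
      trans (∑-allFin-suc k (λ x → when ⌊ x ≟ᶠ Fin.zero ⌋ (g x)))
            (trans (cong (g Fin.zero +_) (∑-zero (allFin k) (λ _ → refl))) (+-identityʳ _))
    allFin-sifts (suc k) (Fin.suc y) g =
      trans (∑-allFin-suc k (λ x → when ⌊ x ≟ᶠ Fin.suc y ⌋ (g x)))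
            (trans (∑-cong (allFin k) (λ x → cong (λ b → when b (g (Fin.suc x)))
                                                  (⌊⌋-map′ (cong Fin.suc) FinP.suc-injective (x ≟ᶠ y))))
                   (allFin-sifts k y (g ∘ Fin.suc)))

  ∑-allVecs-suc : (k m : ℕ) (f : Vec (Fin k) (suc m) → ℕ) →
    ∑ (allVecs k (suc m)) f ≡ ∑[ v ← allVecs k m ] ∑[ x ← allFin k ] f (x ∷ v)
  ∑-allVecs-suc k m f =
    trans (∑-concatMap (λ v → map (_∷ v) (allFin k)) (allVecs k m) f)
          (∑-cong (allVecs k m) (λ v → ∑-map (_∷ v) (allFin k) f))

  ∑-when : (xs : List A) (b : Bool) (f : A → ℕ) → ∑[ x ← xs ] when b (f x) ≡ when b (∑ xs f)
  ∑-when xs true  f = refl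
  ∑-when xs false f = ∑-zero xs (λ _ → refl)

  allVecs-sifting : (k m : ℕ) → Sifting (≡-dec _≟ᶠ_) (allVecs k m)
  sifts (allVecs-sifting k zero)    [] g = +-identityʳ _
  sifts (allVecs-sifting k (suc m)) (r ∷ rs) g =
    trans (∑-allVecs-suc k m _)
          (trans (∑-cong (allVecs k m) headSifted) (sifts (allVecs-sifting k m) rs (λ v → g (r ∷ v))))
    where
    headSifted : ∀ v → ∑[ x ← allFin k ] when ⌊ ≡-dec _≟ᶠ_ (x ∷ v) (r ∷ rs) ⌋ (g (x ∷ v))
                     ≡ when ⌊ ≡-dec _≟ᶠ_ v rs ⌋ (g (r ∷ v))
    headSifted v = begin
        ∑[ x ← allFin k ] when ⌊ ≡-dec _≟ᶠ_ (x ∷ v) (r ∷ rs) ⌋ (g (x ∷ v))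
      ≡⟨ ∑-cong (allFin k) (λ x → trans (cong (λ b → when b (g (x ∷ v))) (⌊≟⌋-∷ x r v rs))
                                        (when-∧ ⌊ x ≟ᶠ r ⌋ _ (g (x ∷ v)))) ⟩
        ∑[ x ← allFin k ] when ⌊ ≡-dec _≟ᶠ_ v rs ⌋ (when ⌊ x ≟ᶠ r ⌋ (g (x ∷ v)))
      ≡⟨ ∑-when (allFin k) _ (λ x → when ⌊ x ≟ᶠ r ⌋ (g (x ∷ v))) ⟩
        when ⌊ ≡-dec _≟ᶠ_ v rs ⌋ (∑[ x ← allFin k ] when ⌊ x ≟ᶠ r ⌋ (g (x ∷ v)))
      ≡⟨ cong (when _) (sifts (allFin-sifting k) r (λ x → g (x ∷ v))) ⟩
        when ⌊ ≡-dec _≟ᶠ_ v rs ⌋ (g (r ∷ v))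
      ∎
      where open ≡-Reasoning

  ∑-permute : (n : ℕ) (σ : Permutation′ n) (g : Fin n → ℕ) →
    ∑ (allFin n) g ≡ ∑[ j ← allFin n ] g (σ ⟨$⟩ʳ j)
  ∑-permute n σ g =
    trans (asVectorSum n g) (trans (Σℕ.sum-permute g σ) (sym (asVectorSum n (λ j → g (σ ⟨$⟩ʳ j)))))
    where
    module Σℕ = MonoidSum +-0-commutativeMonoid
    asVectorSum : (n : ℕ) (g : Fin n → ℕ) → ∑ (allFin n) g ≡ Σℕ.sum g
    asVectorSum zero    g = refl
    asVectorSum (suc n) g = trans (∑-allFin-suc n g) (cong (g Fin.zero +_) (asVectorSum n (g ∘ Fin.suc)))

  symmetric-difference-count : (xs : List A) (a b : A → Bool) →
    count a xs + 2 * count (λ x → b x ∧ (a x xor b x)) xs ≡ count (λ x → a x xor b x) xs + count b xs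
  symmetric-difference-count xs a b = begin
      ∑[ x ← xs ] ⟦ a x ⟧ + 2 * ∑[ x ← xs ] ⟦ b x ∧ (a x xor b x) ⟧
    ≡⟨ cong (∑[ x ← xs ] ⟦ a x ⟧ +_) (sym (∑-* xs 2 _)) ⟩
      ∑[ x ← xs ] ⟦ a x ⟧ + ∑[ x ← xs ] (2 * ⟦ b x ∧ (a x xor b x) ⟧)
    ≡⟨ sym (∑-+ xs _ _) ⟩
      ∑[ x ← xs ] (⟦ a x ⟧ + 2 * ⟦ b x ∧ (a x xor b x) ⟧)
    ≡⟨ ∑-cong xs (λ x → pointwise (a x) (b x)) ⟩
      ∑[ x ← xs ] (⟦ a x xor b x ⟧ + ⟦ b x ⟧)
    ≡⟨ ∑-+ xs _ _ ⟩
      ∑[ x ← xs ] ⟦ a x xor b x ⟧ + ∑[ x ← xs ] ⟦ b x ⟧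
    ∎
    where
    open ≡-Reasoning
    pointwise : (p q : Bool) → ⟦ p ⟧ + 2 * ⟦ q ∧ (p xor q) ⟧ ≡ ⟦ p xor q ⟧ + ⟦ q ⟧
    pointwise true  true  = refl
    pointwise true  false = refl
    pointwise false true  = refl
    pointwise false false = refl

  overlap-count : (xs : List A) (b p q : A → Bool) →
    count (λ x → b x ∧ p x) xs + count (λ x → b x ∧ q x) xs ≤ count b xs + count (λ x → p x ∧ q x) xs
  overlap-count xs b p q =
    subst₂ _≤_ (∑-+ xs _ _) (∑-+ xs _ _) (∑-mono xs (λ x → pointwise (b x) (p x) (q x)))
    where
    pointwise : (β π κ : Bool) → ⟦ β ∧ π ⟧ + ⟦ β ∧ κ ⟧ ≤ ⟦ β ⟧ + ⟦ π ∧ κ ⟧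
    pointwise true  true  true  = ≤-refl
    pointwise true  true  false = ≤-refl
    pointwise true  false true  = s≤s z≤n
    pointwise true  false false = z≤n
    pointwise false π     κ     = z≤n

  count-split : (xs : List A) (a b : A → Bool) →
    count a xs ≡ count (λ x → a x ∧ not (b x)) xs + count (λ x → a x ∧ b x) xs
  count-split xs a b = trans (∑-cong xs (λ x → pointwise (a x) (b x))) (∑-+ xs _ _)
    where
    pointwise : (α β : Bool) → ⟦ α ⟧ ≡ ⟦ α ∧ not β ⟧ + ⟦ α ∧ β ⟧
    pointwise true  true  = refl
    pointwise true  false = refl
    pointwise false β     = refl

  count-allFin : (n : ℕ) → count (λ _ → true) (allFin n) ≡ n
  count-allFin zero    = refl
  count-allFin (suc n) = trans (∑-allFin-suc n (λ _ → 1)) (cong suc (count-allFin n))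

  -- Fibres.  Fix a coordinate i of edges in V₁ × ⋯ × V_{m+1}.  Every edge is
  -- insertAt c i z for a unique code c (an m-tuple) and a unique vertex z ∈ V_i.

  Code : ℕ → Set
  Code m = Vec (Fin (suc m)) m

  codes : (m : ℕ) → List (Code m)
  codes m = allVecs (suc m) m

  ∑-insertAt : (k m : ℕ) (i : Fin (suc m)) (f : Vec (Fin k) (suc m) → ℕ) →
    ∑ (allVecs k (suc m)) f ≡ ∑[ c ← allVecs k m ] ∑[ z ← allFin k ] f (insertAt c i z)
  ∑-insertAt k m       Fin.zero    f = ∑-allVecs-suc k m f
  ∑-insertAt k (suc m) (Fin.suc i) f = begin
      ∑ (allVecs k (suc (suc m))) f
    ≡⟨ ∑-allVecs-suc k (suc m) f ⟩
      ∑[ w ← allVecs k (suc m) ] ∑[ y ← allFin k ] f (y ∷ w)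
    ≡⟨ ∑-swap (allVecs k (suc m)) (allFin k) (λ w y → f (y ∷ w)) ⟩
      ∑[ y ← allFin k ] ∑[ w ← allVecs k (suc m) ] f (y ∷ w)
    ≡⟨ ∑-cong (allFin k) (λ y → ∑-insertAt k m i (λ w → f (y ∷ w))) ⟩
      ∑[ y ← allFin k ] ∑[ c ← allVecs k m ] ∑[ z ← allFin k ] f (y ∷ insertAt c i z)
    ≡⟨ ∑-swap (allFin k) (allVecs k m) (λ y c → ∑[ z ← allFin k ] f (y ∷ insertAt c i z)) ⟩
      ∑[ c ← allVecs k m ] ∑[ y ← allFin k ] ∑[ z ← allFin k ] f (y ∷ insertAt c i z)
    ≡⟨ sym (∑-allVecs-suc k m (λ c → ∑[ z ← allFin k ] f (insertAt c (Fin.suc i) z))) ⟩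
      ∑[ c ← allVecs k (suc m) ] ∑[ z ← allFin k ] f (insertAt c (Fin.suc i) z)
    ∎
    where open ≡-Reasoning

  card-cong : {m : ℕ} {X Y : EdgeSet (suc m)} → (∀ e → X e ≡ Y e) → card X ≡ card Y
  card-cong {m} eq = ∑-cong (allVecs (suc m) (suc m)) (λ e → cong ⟦_⟧ (eq e))

  deg-as-codes : (m : ℕ) (X : EdgeSet (suc m)) (i z : Fin (suc m)) →
    deg X i z ≡ ∑[ c ← codes m ] ⟦ X (insertAt c i z) ⟧
  deg-as-codes m X i z =
    trans (∑-insertAt (suc m) m i (λ e → ⟦ δ X i z e ⟧))
          (∑-cong (codes m) (λ c → trans (∑-cong (allFin (suc m)) (atVertex c))
                                         (sifts (allFin-sifting (suc m)) z (λ y → ⟦ X (insertAt c i y) ⟧))))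
    where
    atVertex : ∀ c y → ⟦ δ X i z (insertAt c i y) ⟧ ≡ when ⌊ y ≟ᶠ z ⌋ ⟦ X (insertAt c i y) ⟧
    atVertex c y rewrite insertAt-lookup c i y = ⟦∧⟧ʳ (X (insertAt c i y)) ⌊ y ≟ᶠ z ⌋

  card-as-degrees : (m : ℕ) (X : EdgeSet (suc m)) (i : Fin (suc m)) →
    card X ≡ ∑[ z ← allFin (suc m) ] deg X i z
  card-as-degrees m X i =
    trans (∑-insertAt (suc m) m i (λ e → ⟦ X e ⟧))
          (trans (∑-swap (codes m) (allFin (suc m)) (λ c z → ⟦ X (insertAt c i z) ⟧))
                 (∑-cong (allFin (suc m)) (λ z → sym (deg-as-codes m X i z))))

  UmbrellaWith : {m : ℕ} → Fin (suc m) → Code m → EdgeSet (suc m) → Set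
  UmbrellaWith {m} q a S = (e : Edge (suc m)) → S e ≡ umbrella q a e

  umbrella-insertAt : {m : ℕ} (q : Fin (suc m)) (a c : Code m) (z : Fin (suc m)) →
    umbrella q a (insertAt c q z) ≡ ⌊ ≡-dec _≟ᶠ_ c a ⌋
  umbrella-insertAt q a c z = cong (λ w → ⌊ ≡-dec _≟ᶠ_ w a ⌋) (removeAt-insertAt c q z)

  umbrella-coordinate : {m : ℕ} {q p : Fin (suc m)} {a : Code m} (E : Edge (suc m)) →
    umbrella q a E ≡ true → (q≢p : q ≢ p) → lookup E p ≡ lookup a (punchOut q≢p)
  umbrella-coordinate {q = q} {a = a} E inU q≢p =
    trans (sym (removeAt-punchOut E q≢p))
          (cong (λ w → lookup w (punchOut q≢p)) (⌊⌋-sound (≡-dec _≟ᶠ_ (removeAt E q) a) inU))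

  umbrella-agree : {m : ℕ} {q p : Fin (suc m)} {a : Code m} {S : EdgeSet (suc m)} {E E′ : Edge (suc m)} →
    UmbrellaWith q a S → S E ≡ true → S E′ ≡ true → q ≢ p → lookup E p ≡ lookup E′ p
  umbrella-agree {E = E} {E′} isU E∈S E′∈S q≢p =
    trans (umbrella-coordinate E (trans (sym (isU E)) E∈S) q≢p)
          (sym (umbrella-coordinate E′ (trans (sym (isU E′)) E′∈S) q≢p))

  umbrella-covers-colour : {m : ℕ} {q : Fin (suc m)} {a : Code m} {S : EdgeSet (suc m)} →
    UmbrellaWith q a S → Covered S q
  umbrella-covers-colour {m} {q} {a} {S} isU z =
    subst (_≤ deg S q z) edgeThrough-z
      (term≤∑ (allVecs-sifting (suc m) (suc m)) (λ e → ⟦ δ S q z e ⟧) (insertAt a q z))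
    where
    edgeThrough-z : ⟦ δ S q z (insertAt a q z) ⟧ ≡ 1
    edgeThrough-z =
      cong ⟦_⟧ (cong₂ _∧_ (trans (isU _) (trans (umbrella-insertAt q a a z) (⌊⌋-true (≡-dec _≟ᶠ_ a a) refl)))
                          (trans (cong (_== z) (insertAt-lookup a q z)) (⌊⌋-true (z ≟ᶠ z) refl)))

  -- An umbrella covers no class besides its colour (given at least two vertices per class).
  umbrella-covers-only-colour : {m : ℕ} {q : Fin (suc m)} {a : Code m} {S : EdgeSet (suc m)} →
    Fin m → UmbrellaWith q a S → (i : Fin (suc m)) → Covered S i → i ≡ q
  umbrella-covers-only-colour {m} {q} {a} {S} j isU i cov with i ≟ᶠ q
  ... | yes i≡q = i≡q
  ... | no  i≢q = ⊥-elim (FinP.0≢1+n (trans (forced Fin.zero) (sym (forced (Fin.suc j)))))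
    where
    q≢i : q ≢ i
    q≢i = i≢q ∘ sym
    -- every vertex z ∈ V_i met by S is the fixed coordinate of the code at position i
    forced : (z : Fin (suc m)) → z ≡ lookup a (punchOut q≢i)
    forced z with count-witness (δ S i z) (allVecs (suc m) (suc m)) (cov z)
    ... | E , E∈δ with ∧-split (S E) (lookup E i == z) E∈δ
    ...   | E∈S , Eᵢ≡z = trans (sym (⌊⌋-sound (lookup E i ≟ᶠ z) Eᵢ≡z))
                               (umbrella-coordinate E (trans (sym (isU E)) E∈S) q≢i)

  umbrellas-share-one-code : {m : ℕ} {q q′ : Fin (suc m)} {a a′ : Code m} {S S′ : EdgeSet (suc m)} →
    UmbrellaWith q a S → UmbrellaWith q′ a′ S′ → q ≢ q′ → (i z z′ : Fin (suc m)) (c c′ : Code m) →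
    S (insertAt c i z) ≡ true → S′ (insertAt c i z′) ≡ true →
    S (insertAt c′ i z) ≡ true → S′ (insertAt c′ i z′) ≡ true → c ≡ c′
  umbrellas-share-one-code {q = q} {q′} {S = S} {S′} isU isU′ q≢q′ i z z′ c c′ c∈S c∈S′ c′∈S c′∈S′ =
    trans (sym (tabulate∘lookup c)) (trans (tabulate-cong sameAt) (tabulate∘lookup c′))
    where
    -- position p of a code is position punchIn i p of its edges
    through : ∀ p w → lookup (insertAt c i w) (punchIn i p) ≡ lookup (insertAt c′ i w) (punchIn i p) →
              lookup c p ≡ lookup c′ p
    through p w eq = trans (sym (insertAt-punchIn c i w p)) (trans eq (insertAt-punchIn c′ i w p))
    -- that position is fixed by the first umbrella unless it is q, and then by the second
    sameAt : ∀ p → lookup c p ≡ lookup c′ p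
    sameAt p with q ≟ᶠ punchIn i p
    ... | no  q≢ = through p z (umbrella-agree isU c∈S c′∈S q≢)
    ... | yes q≡ = through p z′ (umbrella-agree isU′ c∈S′ c′∈S′ (λ e → q≢q′ (trans q≡ (sym e))))

  -- The integer form of the bound: with m = N₀ + O, O = N₁ + P and C = u + D, the
  -- natural-number inequality S₀ + u N₀ + 1 ≤ D + u N₁ + P + u is the claimed one.
  integer-form : {u m O P S₀ N₀ N₁ D C : ℕ} → m ≡ N₀ + O → O ≡ N₁ + P → C ≡ u + D →
    S₀ + u * N₀ + 1 ≤ D + u * N₁ + P + u →
    ℤ.+ u ℤ.* (ℤ.+ suc m ℤ.- ℤ.+ O) ℤ.+ ℤ.+ S₀ ℤ.- ℤ.+ u ℤ.* (ℤ.+ O ℤ.- ℤ.+ P)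
      ℤ.- ℤ.+ u ℤ.- ℤ.+ P ℤ.+ ℤ.+ 1 ℤ.≤ ℤ.+ C
  integer-form {u} {_} {_} {P} {S₀} {N₀} {N₁} {D} refl refl refl h = begin
      ℤ.+ u ℤ.* (ℤ.+ suc (N₀ + (N₁ + P)) ℤ.- ℤ.+ (N₁ + P)) ℤ.+ ℤ.+ S₀
        ℤ.- ℤ.+ u ℤ.* (ℤ.+ (N₁ + P) ℤ.- ℤ.+ P) ℤ.- ℤ.+ u ℤ.- ℤ.+ P ℤ.+ ℤ.+ 1
    ≡⟨ lhs-identity (ℤ.+ u) (ℤ.+ N₀) (ℤ.+ N₁) (ℤ.+ P) (ℤ.+ S₀) ⟩
      (ℤ.+ S₀ ℤ.+ ℤ.+ u ℤ.* ℤ.+ N₀ ℤ.+ ℤ.+ 1) ℤ.- (ℤ.+ u ℤ.* ℤ.+ N₁ ℤ.+ ℤ.+ P)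
    ≤⟨ ℤP.+-monoˡ-≤ (ℤ.- (ℤ.+ u ℤ.* ℤ.+ N₁ ℤ.+ ℤ.+ P)) h-in-ℤ ⟩
      (ℤ.+ D ℤ.+ ℤ.+ u ℤ.* ℤ.+ N₁ ℤ.+ ℤ.+ P ℤ.+ ℤ.+ u) ℤ.- (ℤ.+ u ℤ.* ℤ.+ N₁ ℤ.+ ℤ.+ P)
    ≡⟨ rhs-identity (ℤ.+ u) (ℤ.+ N₁) (ℤ.+ P) (ℤ.+ D) ⟩
      ℤ.+ (u + D)
    ∎
    where
    open ℤP.≤-Reasoning
    lhs-identity : ∀ (U n₀ n₁ p σ : ℤ.ℤ) →
      U ℤ.* ((ℤ.+ 1 ℤ.+ (n₀ ℤ.+ (n₁ ℤ.+ p))) ℤ.- (n₁ ℤ.+ p)) ℤ.+ σ ℤ.- U ℤ.* ((n₁ ℤ.+ p) ℤ.- p)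
        ℤ.- U ℤ.- p ℤ.+ ℤ.+ 1
      ≡ (σ ℤ.+ U ℤ.* n₀ ℤ.+ ℤ.+ 1) ℤ.- (U ℤ.* n₁ ℤ.+ p)
    lhs-identity = ℤ-solve-∀
    rhs-identity : ∀ (U n₁ p δ : ℤ.ℤ) → (δ ℤ.+ U ℤ.* n₁ ℤ.+ p ℤ.+ U) ℤ.- (U ℤ.* n₁ ℤ.+ p) ≡ U ℤ.+ δ
    rhs-identity = ℤ-solve-∀
    -- the embedding ℕ → ℤ preserves + definitionally, and * by pos-*
    h-in-ℤ : ℤ.+ S₀ ℤ.+ ℤ.+ u ℤ.* ℤ.+ N₀ ℤ.+ ℤ.+ 1 ℤ.≤ ℤ.+ D ℤ.+ ℤ.+ u ℤ.* ℤ.+ N₁ ℤ.+ ℤ.+ P ℤ.+ ℤ.+ u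
    h-in-ℤ = subst₂ ℤ._≤_ (cong (λ w → ℤ.+ S₀ ℤ.+ w ℤ.+ ℤ.+ 1) (ℤP.pos-* u N₀))
                          (cong (λ w → ℤ.+ D ℤ.+ w ℤ.+ ℤ.+ P ℤ.+ ℤ.+ u) (ℤP.pos-* u N₁))
                          (ℤ.+≤+ h)

  -- The suitable decomposition.  In V_{i₁}, x₁ is the vertex of least degree and
  -- y k = x_{k+2} is the vertex whose fibre gives Ω_{k+2} = Ωs k.

  module Decomposition {m : ℕ} {Ω : EdgeSet (suc m)} {𝒰 : UmbrellaSet m} {Ωs : Fin m → EdgeSet (suc m)}
                       (D : SuitableDecomposition Ω 𝒰 Ωs) where

    open SuitableDecomposition D

    x₁ : Fin (suc m)
    x₁ = x Fin.zero

    y : Fin m → Fin (suc m)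
    y k = x (Fin.suc k)

    u : ℕ
    u = cardU 𝒰

    d s t : Fin m → ℕ
    d k = deg Ω i₁ (y k)
    s k = card (Ωs k)
    t k = count (λ c → 𝒰 c ∧ Ωs k (insertAt c i₁ (y k))) (codes m)

    Σd : ℕ
    Σd = ∑ (allFin m) d

    -- The only umbrella of colour V_{i₁} through the edge with code c is the one with
    -- code c, so the number of members of 𝒰 through that edge is ⟦ 𝒰 c ⟧.
    umbrellas-through : (c : Code m) (z : Fin (suc m)) →
      count (λ c′ → 𝒰 c′ ∧ umbrella i₁ c′ (insertAt c i₁ z)) (codes m) ≡ ⟦ 𝒰 c ⟧
    umbrellas-through c z =
      trans (∑-cong (codes m) (λ c′ → trans (cong (λ b → ⟦ 𝒰 c′ ∧ b ⟧)
                                                   (trans (umbrella-insertAt i₁ c′ c z) (⌊≟⌋-sym (≡-dec _≟ᶠ_) c c′)))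
                                            (⟦∧⟧ʳ (𝒰 c′) ⌊ ≡-dec _≟ᶠ_ c′ c ⌋)))
            (sifts (allVecs-sifting (suc m) m) c (λ c′ → ⟦ 𝒰 c′ ⟧))

    W-fibre : (c : Code m) (z : Fin (suc m)) → W (insertAt c i₁ z) ≡ 𝒰 c
    W-fibre c z rewrite umbrellas-through c z with 𝒰 c
    ... | true  = refl
    ... | false = refl

    𝒰-fibre : (c : Code m) → 𝒰 c ≡ Ω (insertAt c i₁ x₁)
    𝒰-fibre c = trans (𝒰-def c) (any-from-count _ (allVecs (suc m) (suc m)) _ edgesOfUmbrella)
      where
      edgesOfUmbrella : count (λ e → umbrella i₁ c e ∧ δ Ω i₁ x₁ e) (allVecs (suc m) (suc m))
                        ≡ ⟦ Ω (insertAt c i₁ x₁) ⟧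
      edgesOfUmbrella = begin
          count (λ e → umbrella i₁ c e ∧ δ Ω i₁ x₁ e) (allVecs (suc m) (suc m))
        ≡⟨ ∑-cong (allVecs (suc m) (suc m)) (λ e → cong ⟦_⟧ (sym (∧-assoc (umbrella i₁ c e) (Ω e) _))) ⟩
          deg (λ e → umbrella i₁ c e ∧ Ω e) i₁ x₁
        ≡⟨ deg-as-codes m _ i₁ x₁ ⟩
          ∑[ c′ ← codes m ] ⟦ umbrella i₁ c (insertAt c′ i₁ x₁) ∧ Ω (insertAt c′ i₁ x₁) ⟧
        ≡⟨ ∑-cong (codes m) (λ c′ → trans (cong (λ b → ⟦ b ∧ Ω (insertAt c′ i₁ x₁) ⟧) (umbrella-insertAt i₁ c c′ x₁))
                                          (⟦∧⟧ˡ ⌊ ≡-dec _≟ᶠ_ c′ c ⌋ (Ω (insertAt c′ i₁ x₁)))) ⟩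
          ∑[ c′ ← codes m ] when ⌊ ≡-dec _≟ᶠ_ c′ c ⌋ ⟦ Ω (insertAt c′ i₁ x₁) ⟧
        ≡⟨ sifts (allVecs-sifting (suc m) m) c (λ c′ → ⟦ Ω (insertAt c′ i₁ x₁) ⟧) ⟩
          ⟦ Ω (insertAt c i₁ x₁) ⟧
        ∎
        where open ≡-Reasoning

    u≡deg-x₁ : u ≡ deg Ω i₁ x₁
    u≡deg-x₁ = trans (∑-cong (codes m) (cong ⟦_⟧ ∘ 𝒰-fibre)) (sym (deg-as-codes m Ω i₁ x₁))

    Ωs-fibre : (k : Fin m) (c : Code m) → Ωs k (insertAt c i₁ (y k)) ≡ Ω (insertAt c i₁ (y k)) xor 𝒰 c
    Ωs-fibre k c =
      trans (Ωs-def k _)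
            (trans (cong₂ (λ w b → (Ω (insertAt c i₁ (y k)) xor w) ∧ b)
                          (W-fibre c (y k))
                          (trans (cong (_== y k) (insertAt-lookup c i₁ (y k))) (⌊⌋-true (y k ≟ᶠ y k) refl)))
                   (∧-identityʳ _))

    s-as-codes : (k : Fin m) → s k ≡ count (λ c → Ω (insertAt c i₁ (y k)) xor 𝒰 c) (codes m)
    s-as-codes k =
      trans (card-cong (Ωs-def k))
            (trans (deg-as-codes m (Ω △ W) i₁ (y k))
                   (∑-cong (codes m) (λ c → cong (λ w → ⟦ Ω (insertAt c i₁ (y k)) xor w ⟧) (W-fibre c (y k)))))

    -- The basic count d_k + 2 t_k = s_k + u  (|A| + 2|𝒰 ∖ A| = |A △ 𝒰| + |𝒰|).
    twisted-count : (k : Fin m) → d k + 2 * t k ≡ s k + u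
    twisted-count k = begin
        d k + 2 * t k
      ≡⟨ cong₂ _+_ (deg-as-codes m Ω i₁ (y k))
                   (cong (2 *_) (∑-cong (codes m) (λ c → cong (λ b → ⟦ 𝒰 c ∧ b ⟧) (Ωs-fibre k c)))) ⟩
        count F (codes m) + 2 * count (λ c → 𝒰 c ∧ (F c xor 𝒰 c)) (codes m)
      ≡⟨ symmetric-difference-count (codes m) F 𝒰 ⟩
        count (λ c → F c xor 𝒰 c) (codes m) + u
      ≡⟨ cong (_+ u) (sym (s-as-codes k)) ⟩
        s k + u
      ∎
      where
      open ≡-Reasoning
      F : Code m → Bool
      F c = Ω (insertAt c i₁ (y k))

    t≤u : (k : Fin m) → t k ≤ u
    t≤u k = ∑-mono (codes m) (λ c → subst (_≤ ⟦ 𝒰 c ⟧) (sym (⟦∧⟧ʳ (𝒰 c) (F c))) (when-≤ (F c) ⟦ 𝒰 c ⟧))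
      where
      F : Code m → Bool
      F c = Ωs k (insertAt c i₁ (y k))

    -- V_{i₁} is covered, and x₁ has least degree in it.
    1≤u : 1 ≤ u
    1≤u = subst (1 ≤_) (sym u≡deg-x₁) (i₁-covered x₁)

    u≤d : (k : Fin m) → u ≤ d k
    u≤d k = subst (_≤ d k) (sym u≡deg-x₁) (σ-sorted Fin.zero (Fin.suc k) z≤n)

    card-Ω : card Ω ≡ u + Σd
    card-Ω = begin
        card Ω
      ≡⟨ card-as-degrees m Ω i₁ ⟩
        ∑[ z ← allFin (suc m) ] deg Ω i₁ z
      ≡⟨ ∑-permute (suc m) σ (deg Ω i₁) ⟩
        ∑[ j ← allFin (suc m) ] deg Ω i₁ (x j)
      ≡⟨ ∑-allFin-suc m (λ j → deg Ω i₁ (x j)) ⟩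
        deg Ω i₁ x₁ + Σd
      ≡⟨ cong (_+ Σd) (sym u≡deg-x₁) ⟩
        u + Σd
      ∎
      where open ≡-Reasoning

    -- If Ω_{k+2} and Ω_{l+2} are umbrellas of distinct colours, they share at most one
    -- code on the fibres of y k and y l, so t_k + t_l ≤ u + 1.
    umbrella-pair-bound : (k l : Fin m) {q q′ : Fin (suc m)} {a a′ : Code m} →
      UmbrellaWith q a (Ωs k) → UmbrellaWith q′ a′ (Ωs l) → q ≢ q′ → t k + t l ≤ u + 1
    umbrella-pair-bound k l isU isU′ q≢q′ = begin
        t k + t l
      ≤⟨ overlap-count (codes m) 𝒰 (F k) (F l) ⟩
        u + count (λ c → F k c ∧ F l c) (codes m)
      ≤⟨ +-monoʳ-≤ u (∑-single≤ (allVecs-sifting (suc m) m) _ 1 (λ c → when-≤ (F k c ∧ F l c) 1) shared-once) ⟩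
        u + 1
      ∎
      where
      open ≤-Reasoning
      F : Fin m → Code m → Bool
      F j c = Ωs j (insertAt c i₁ (y j))
      shared-once : ∀ c c′ → 1 ≤ ⟦ F k c ∧ F l c ⟧ → 1 ≤ ⟦ F k c′ ∧ F l c′ ⟧ → c ≡ c′
      shared-once c c′ h h′ with ∧-split _ _ (⟦⟧-positive _ h) | ∧-split _ _ (⟦⟧-positive _ h′)
      ... | c∈S , c∈S′ | c′∈S , c′∈S′ =
        umbrellas-share-one-code isU isU′ q≢q′ i₁ (y k) (y l) c c′ c∈S c∈S′ c′∈S c′∈S′

    s≤d+u : (k : Fin m) → s k ≤ d k + u
    s≤d+u k = +-cancelʳ-≤ u (s k) (d k + u) (begin
        s k + u        ≡⟨ sym (twisted-count k) ⟩
        d k + 2 * t k  ≤⟨ +-monoʳ-≤ (d k) (*-monoʳ-≤ 2 (t≤u k)) ⟩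
        d k + 2 * u    ≡⟨ regroup (d k) u ⟩
        d k + u + u    ∎)
      where
      open ≤-Reasoning
      regroup : ∀ a b → a + 2 * b ≡ a + b + b
      regroup = solve-∀

    excess : Fin m → ℕ
    excess k = 2 * t k ∸ (u + 1)

    s≤d+1+excess : (k : Fin m) → s k ≤ d k + 1 + excess k
    s≤d+1+excess k = +-cancelʳ-≤ u (s k) (d k + 1 + excess k) (begin
        s k + u                              ≡⟨ sym (twisted-count k) ⟩
        d k + 2 * t k                        ≤⟨ +-monoʳ-≤ (d k) (m≤n+m∸n (2 * t k) (u + 1)) ⟩
        d k + ((u + 1) + excess k)           ≡⟨ regroup (d k) u (excess k) ⟩
        d k + 1 + excess k + u               ∎)
      where
      open ≤-Reasoning
      regroup : ∀ a b c → a + ((b + 1) + c) ≡ a + 1 + c + b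
      regroup = solve-∀

    excess≤ : (k : Fin m) → excess k ≤ u ∸ 1
    excess≤ k = begin
        2 * t k ∸ (u + 1)    ≤⟨ ∸-monoˡ-≤ (u + 1) (*-monoʳ-≤ 2 (t≤u k)) ⟩
        2 * u ∸ (u + 1)      ≡⟨ cong (_∸ (u + 1)) (cong (u +_) (+-identityʳ u)) ⟩
        (u + u) ∸ (u + 1)    ≡⟨ [m+n]∸[m+o]≡n∸o u u 1 ⟩
        u ∸ 1                ∎
      where open ≤-Reasoning

    excess-positive : (k : Fin m) → 1 ≤ excess k → u + 1 < 2 * t k
    excess-positive k h = m∸n≢0⇒n<m (λ e → contradiction (subst (1 ≤_) e h) λ ())

  module Accounting {m : ℕ} {Ω : EdgeSet (suc m)} {𝒰 : UmbrellaSet m} {Ωs : Fin m → EdgeSet (suc m)}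
    (D : SuitableDecomposition Ω 𝒰 Ωs) (𝒪 𝒫 : Fin m → Bool)
    (private-class : (k : Fin m) → 𝒪 k ≡ true →
      ∃[ i ] (Covered (Ωs k) i × ((l : Fin m) → 𝒪 l ≡ true → l ≢ k → ¬ Covered (Ωs l) i)))
    (𝒫-umbrellas : (k : Fin m) → (𝒫 k ≡ true) ⇔ ((𝒪 k ≡ true) × IsUmbrella (Ωs k))) where

    open Decomposition D public

    𝒫⊆𝒪 : (k : Fin m) → 𝒫 k ≡ true → 𝒪 k ≡ true
    𝒫⊆𝒪 k h = proj₁ (Equivalence.to (𝒫-umbrellas k) h)

    -- Distinct members of 𝒫 have distinct colours: the colour is the only class an
    -- umbrella covers, and the private class of a member of 𝒪 is covered by no other.
    𝒫-colours-distinct : (k l : Fin m) → l ≢ k → 𝒫 k ≡ true → 𝒫 l ≡ true →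
      {q q′ : Fin (suc m)} {a a′ : Code m} →
      UmbrellaWith q a (Ωs k) → UmbrellaWith q′ a′ (Ωs l) → q ≢ q′
    𝒫-colours-distinct k l l≢k k∈𝒫 l∈𝒫 isU isU′ q≡q′ with private-class k (𝒫⊆𝒪 k k∈𝒫)
    ... | i , k-covers , no-other =
      no-other l (𝒫⊆𝒪 l l∈𝒫) l≢k
        (subst (Covered (Ωs l)) (sym (trans (umbrella-covers-only-colour k isU i k-covers) q≡q′))
               (umbrella-covers-colour isU′))

    e : Fin m → ℕ
    e k = when (𝒫 k) (excess k)

    -- At most one index carries a positive excess: for distinct k, l ∈ 𝒫 it would give
    -- 2 t_k + 2 t_l > 2(u + 1), against umbrella-pair-bound.
    excess-unique : (k l : Fin m) → 1 ≤ e k → 1 ≤ e l → k ≡ l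
    excess-unique k l hk hl with k ≟ᶠ l | when-positive (𝒫 k) _ hk | when-positive (𝒫 l) _ hl
    ... | yes k≡l | _ | _ = k≡l
    ... | no k≢l | k∈𝒫 , exₖ | l∈𝒫 , exₗ
      with proj₂ (Equivalence.to (𝒫-umbrellas k) k∈𝒫) | proj₂ (Equivalence.to (𝒫-umbrellas l) l∈𝒫)
    ...   | _ , _ , isU | _ , _ , isU′ = ⊥-elim (<-irrefl refl (begin-strict
        (u + 1) + (u + 1)   <⟨ +-mono-< (excess-positive k exₖ) (excess-positive l exₗ) ⟩
        2 * t k + 2 * t l   ≡⟨ sym (*-distribˡ-+ 2 (t k) (t l)) ⟩
        2 * (t k + t l)     ≤⟨ *-monoʳ-≤ 2 (umbrella-pair-bound k l isU isU′
                                             (𝒫-colours-distinct k l (k≢l ∘ sym) k∈𝒫 l∈𝒫 isU isU′)) ⟩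
        2 * (u + 1)         ≡⟨ cong ((u + 1) +_) (+-identityʳ (u + 1)) ⟩
        (u + 1) + (u + 1)   ∎))
      where open ≤-Reasoning

    ∑e≤ : ∑ (allFin m) e ≤ u ∸ 1
    ∑e≤ = ∑-single≤ (allFin-sifting m) e (u ∸ 1) (λ k → ≤-trans (when-≤ (𝒫 k) _) (excess≤ k)) excess-unique

    term : Fin m → ℕ
    term k = if 𝒪 k then s k else u

    charge : Fin m → ℕ
    charge k = d k + when (𝒪 k ∧ not (𝒫 k)) u + ⟦ 𝒫 k ⟧

    term≤charge : (k : Fin m) → term k ≤ charge k + e k
    term≤charge k with 𝒫 k in k∈𝒫 | 𝒪 k in k∈𝒪
    ... | true  | false = contradiction (trans (sym (𝒫⊆𝒪 k k∈𝒫)) k∈𝒪) λ ()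
    ... | true  | true  = subst (s k ≤_) (cong (λ w → w + 1 + excess k) (sym (+-identityʳ (d k)))) (s≤d+1+excess k)
    ... | false | true  = subst (s k ≤_) (sym (trans (+-identityʳ _) (+-identityʳ _))) (s≤d+u k)
    ... | false | false = subst (u ≤_) (sym (trans (+-identityʳ _) (trans (+-identityʳ _) (+-identityʳ _)))) (u≤d k)

    N₀ N₁ : ℕ
    N₀ = count (λ k → not (𝒪 k)) (allFin m)
    N₁ = count (λ k → 𝒪 k ∧ not (𝒫 k)) (allFin m)

    m≡N₀+|𝒪| : m ≡ N₀ + cardI 𝒪
    m≡N₀+|𝒪| = trans (sym (count-allFin m)) (count-split (allFin m) (λ _ → true) 𝒪)

    |𝒪|≡N₁+|𝒫| : cardI 𝒪 ≡ N₁ + cardI 𝒫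
    |𝒪|≡N₁+|𝒫| = trans (count-split (allFin m) 𝒪 𝒫) (cong (N₁ +_) (∑-cong (allFin m) 𝒪∧𝒫≡𝒫))
      where
      𝒪∧𝒫≡𝒫 : (k : Fin m) → ⟦ 𝒪 k ∧ 𝒫 k ⟧ ≡ ⟦ 𝒫 k ⟧
      𝒪∧𝒫≡𝒫 k with 𝒫 k in k∈𝒫
      ... | true  rewrite 𝒫⊆𝒪 k k∈𝒫 = refl
      ... | false = cong ⟦_⟧ (∧-zeroʳ (𝒪 k))

    ∑term : ∑ (allFin m) term ≡ sumOver 𝒪 Ωs + u * N₀
    ∑term = trans (∑-cong (allFin m) (λ k → pointwise (𝒪 k) (s k)))
                  (trans (∑-+ (allFin m) _ _) (cong (sumOver 𝒪 Ωs +_) (∑-* (allFin m) u _)))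
      where
      pointwise : (o : Bool) (z : ℕ) → (if o then z else u) ≡ when o z + u * ⟦ not o ⟧
      pointwise true  z = sym (trans (cong (z +_) (*-zeroʳ u)) (+-identityʳ z))
      pointwise false z = sym (*-identityʳ u)

    ∑charge : ∑ (allFin m) charge ≡ Σd + u * N₁ + cardI 𝒫
    ∑charge =
      trans (∑-cong (allFin m) (λ k → cong (λ w → d k + w + ⟦ 𝒫 k ⟧) (when-as-product (𝒪 k ∧ not (𝒫 k)) u)))
            (trans (∑-+ (allFin m) _ _)
                   (cong (_+ cardI 𝒫) (trans (∑-+ (allFin m) _ _) (cong (Σd +_) (∑-* (allFin m) u _)))))

    natural-bound : sumOver 𝒪 Ωs + u * N₀ + 1 ≤ Σd + u * N₁ + cardI 𝒫 + u
    natural-bound = begin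
        sumOver 𝒪 Ωs + u * N₀ + 1                  ≡⟨ cong (_+ 1) (sym ∑term) ⟩
        ∑ (allFin m) term + 1                      ≤⟨ +-monoˡ-≤ 1 (∑-mono (allFin m) term≤charge) ⟩
        ∑[ k ← allFin m ] (charge k + e k) + 1      ≡⟨ cong (_+ 1) (∑-+ (allFin m) charge e) ⟩
        ∑ (allFin m) charge + ∑ (allFin m) e + 1    ≤⟨ +-monoˡ-≤ 1 (+-monoʳ-≤ (∑ (allFin m) charge) ∑e≤) ⟩
        ∑ (allFin m) charge + (u ∸ 1) + 1          ≡⟨ +-assoc (∑ (allFin m) charge) (u ∸ 1) 1 ⟩
        ∑ (allFin m) charge + ((u ∸ 1) + 1)        ≡⟨ cong₂ _+_ ∑charge (m∸n+n≡m 1≤u) ⟩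
        Σd + u * N₁ + cardI 𝒫 + u                  ∎
      where open ≤-Reasoning

open import Data.Nat using (ℕ; suc)
open import Data.Integer using (ℤ; +_; _+_; _-_; _*_; _≤_)
open import Data.Bool using (Bool; true)
open import Data.Fin using (Fin)
open import Data.Product using (_×_; ∃-syntax)
open import Relation.Nullary using (¬_)
open import Relation.Binary.PropositionalEquality using (_≡_; _≢_)
open import Function.Bundles using (_⇔_)

proposition4 : (m : ℕ) (Ω : EdgeSet (suc m)) → Octahedral Ω → Nonempty Ω →
    (𝒰 : UmbrellaSet m) (Ωs : Fin m → EdgeSet (suc m)) → SuitableDecomposition Ω 𝒰 Ωs →
    (𝒪 : Fin m → Bool) →
    ((k : Fin m) → 𝒪 k ≡ true →
    ∃[ i ] (Covered (Ωs k) i × ((l : Fin m) → 𝒪 l ≡ true → l ≢ k → ¬ Covered (Ωs l) i))) →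
    (𝒫 : Fin m → Bool) →
    ((k : Fin m) → (𝒫 k ≡ true) ⇔ ((𝒪 k ≡ true) × IsUmbrella (Ωs k))) →
    (+ cardU 𝒰) * (+ suc m - + cardI 𝒪) + + sumOver 𝒪 Ωs
    - (+ cardU 𝒰) * (+ cardI 𝒪 - + cardI 𝒫) - + cardU 𝒰 - + cardI 𝒫 + + 1
    ≤ + card Ω
proposition4 m Ω _ _ 𝒰 Ωs D 𝒪 private-class 𝒫 𝒫-umbrellas =
  integer-form {u = u} {P = cardI 𝒫} {S₀ = sumOver 𝒪 Ωs} {N₀ = N₀} {N₁ = N₁} {D = Σd}
               m≡N₀+|𝒪| |𝒪|≡N₁+|𝒫| card-Ω natural-bound
  where
  open Development using (integer-form)
  open Development.Accounting D 𝒪 𝒫 private-class 𝒫-umbrellas
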